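{- Let $\mathcal{P}=(P,\leq^\mathcal{P})$ be a finite colored poset with a fixed chain partition and $s\ge0$. Assume $p,p',q,q'\in P$ satisfy $\tau_s(p)=\tau_s(p')$ and $\tau_s(q)=\tau_s(q')$, and that $(p,q)$ and $(p',q')$ are arcs of $D_s$ with the same label. If $p\leq^\mathcal{P}p'$ then $q\leq^\mathcal{P}q'$.
   Context: $\mathcal{P}$ is colored by $\lambda:P\to\Lambda$ ($\Lambda$ finite) and has a chain partition $(C_1,\dots,C_w)$; $C(p)=C_j$ for $p\in C_j$. Digraphs may have labeled vertices and arcs and parallel arcs; $R^D_r(v_1,\dots,v_k)$ is the set of vertices reachable in $D$ from some $v_i$ by a directed path of length at most $r$. Put $r_s=3\cdot4^s-1$. Let $\tau_0(p)=\langle\lambda(p),j\rangle$ where $C(p)=C_j$. Given $\tau_s$, $D_s$ is the digraph on $P$ with vertex labels $\tau_s$ and arcs: for every $p\in P$ and $j\in\{1,\dots,w\}$, an arc labeled 'max' from $p$ to the topmost element of $C_j$, an arc labeled 'min' from $p$ to the bottommost element of $C_j$, and for every value $t\in\{\tau_s(q):q\in C_j\}$ an arc labeled 'up' from $p$ to the bottommost $p'\in C_j$ with $p'\ne p$, $\tau_s(p')=t$, $p\leq^\mathcal{P}p'$ (if it exists) and an arc labeled 'down' from $p$ to the topmost $p'\in C_j$ with $p'\ne p$, $\tau_s(p')=t$, $p'\leq^\mathcal{P}p$ (if it exists). Let $P_s(p)=R^{D_s}_{r_s}(p)$ and $\mathcal{A}_s(p)$ the structure formed by the vertex- and arc-labeled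 induced subdigraph $D_s[P_s(p)]$ rooted at $p$ with $\leq^\mathcal{P}$ restricted to $P_s(p)$; $\tau_{s+1}(p)$ is the isomorphism type of $\mathcal{A}_s(p)$. -}

module Defs where

open import Data.Nat using (ℕ; zero; suc; _*_; _∸_; _^_)
open import Data.Fin using (Fin)
open import Data.Product using (Σ; _×_; _,_; ∃)
open import Data.Sum using (_⊎_)
open import Relation.Nullary using (¬_)
open import Relation.Binary.PropositionalEquality using (_≡_)
open import Relation.Binary.Structures using (IsPartialOrder)

-- A finite colored poset with a fixed chain partition.
-- The ground set is P = Fin n; colors are in the finite set Λ = Fin k;
-- chainOf p = j means p ∈ C_j (chains C_1,…,C_w indexed by Fin w).
record ColoredPoset : Set₁ where
  field
    n k w      : ℕ
    _≤P_       : Fin n → Fin n → Set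
    isPO       : IsPartialOrder _≡_ _≤P_
    colour     : Fin n → Fin k
    chainOf    : Fin n → Fin w
    chainTotal : ∀ p q → chainOf p ≡ chainOf q → (p ≤P q) ⊎ (q ≤P p)

data Label : Set where
  max min up down : Label

r : ℕ → ℕ
r s = 3 * 4 ^ s ∸ 1

module _ (𝒫 : ColoredPoset) where
  open ColoredPoset 𝒫

  P : Set
  P = Fin n

  -- Arcs of D_s, given the relation "τ_s(x) = τ_s(y)" (written T x y).
  -- Arc T l p q : there is an arc labeled l from p to q.
  -- (For a fixed label and fixed endpoints there is at most one such arc.)
  Arc : (P → P → Set) → Label → P → P → Set
  Arc T max p q = ∀ q' → chainOf q' ≡ chainOf q → q' ≤P q
  Arc T min p q = ∀ q' → chainOf q' ≡ chainOf q → q ≤P q'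
  Arc T up p q = ¬ (q ≡ p) × (p ≤P q) ×
    (∀ q' → chainOf q' ≡ chainOf q → ¬ (q' ≡ p) → T q' q → p ≤P q' → q ≤P q')
  Arc T down p q = ¬ (q ≡ p) × (q ≤P p) ×
    (∀ q' → chainOf q' ≡ chainOf q → ¬ (q' ≡ p) → T q' q → q' ≤P p → q' ≤P q)

  Reach : (P → P → Set) → ℕ → P → P → Set
  Reach T zero    p x = p ≡ x
  Reach T (suc m) p x = (p ≡ x) ⊎ Σ P (λ z → Σ Label (λ l → Arc T l p z × Reach T m z x))

  _⇔_ : Set → Set → Set
  A ⇔ B = (A → B) × (B → A)

  -- Isomorphism of the rooted structures 𝒜(p) and 𝒜(p') built from the
  -- vertex-label relation T and radius m: a bijection between
  -- R_m(p) and R_m(p') sending p to p', preserving vertex labels, labeled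
  -- arcs of the induced subdigraph, and the order ≤^𝒫.
  Iso : (P → P → Set) → ℕ → P → P → Set
  Iso T m p p' =
    Σ (P → P) λ f → Σ (P → P) λ g →
      (∀ x → Reach T m p x → Reach T m p' (f x)) ×
      (∀ y → Reach T m p' y → Reach T m p (g y)) ×
      (∀ x → Reach T m p x → g (f x) ≡ x) ×
      (∀ y → Reach T m p' y → f (g y) ≡ y) ×
      (f p ≡ p') ×
      (∀ x → Reach T m p x → T x (f x)) ×
      (∀ x y → Reach T m p x → Reach T m p y →
         ((x ≤P y) ⇔ (f x ≤P f y)) ×
         (∀ l → Arc T l x y ⇔ Arc T l (f x) (f y)))

  -- TauEq s x y : τ_s(x) = τ_s(y).
  -- τ_0(p) = ⟨λ(p), j⟩ with C(p) = C_j;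
  -- τ_{s+1}(p) = isomorphism type of 𝒜_s(p).
  TauEq : ℕ → P → P → Set
  TauEq zero    x y = (colour x ≡ colour y) × (chainOf x ≡ chainOf y)
  TauEq (suc s) x y = Iso (TauEq s) (r s) x y

  D : ℕ → Label → P → P → Set
  D s = Arc (TauEq s)

module Submission where

-- The four kinds of arcs of D_s are determined by extremal
-- choices inside a chain, so their targets move monotonically with their
-- sources: if both targets lie in the same chain and carry the same vertex
-- label, then
--   * 'max'/'min' targets are the top/bottom of that chain, hence equal;
--   * an 'up' target q of p is the least element of its chain above p with
--     its label, and q' (an 'up' target of p' ≥ p) is such an element, so
--     q ≤ q'; dually for 'down'.  Then we show that τ_s-equality is symmetric and
-- forces equal chains (τ_0 records the chain index, and an isomorphism of
-- the rooted structures 𝒜_s preserves τ_s of the root).  The theorem is the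
-- combination.

open import Defs
open import Data.Nat using (ℕ; zero; suc)
open import Data.Product using (_×_; _,_)
open import Data.Sum using (inj₁)
open import Relation.Nullary using (¬_)
open import Relation.Binary.PropositionalEquality
  using (_≡_; refl; sym; trans; cong; subst; subst₂)
open import Relation.Binary.Structures using (IsPartialOrder)

module _ (𝒫 : ColoredPoset) where
  open ColoredPoset 𝒫
  open IsPartialOrder isPO using (antisym) renaming (trans to ≤-trans)

  -- These transfer the side condition "p' ≠ p" of 'up'/'down' arcs.
  distinct-below : ∀ {p p' x} → p ≤P p' → p' ≤P x → ¬ (x ≡ p') → ¬ (x ≡ p)
  distinct-below p≤p' p'≤x x≢p' refl = x≢p' (antisym p≤p' p'≤x)

  distinct-above : ∀ {p p' x} → p ≤P p' → x ≤P p → ¬ (x ≡ p) → ¬ (x ≡ p')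
  distinct-above p≤p' x≤p x≢p refl = x≢p (antisym x≤p p≤p')

  arcTarget-monotone : (T : P 𝒫 → P 𝒫 → Set) (l : Label) {p p' q q' : P 𝒫} →
    T q q' → T q' q → chainOf q ≡ chainOf q' →
    Arc 𝒫 T l p q → Arc 𝒫 T l p' q' → p ≤P p' → q ≤P q'
  arcTarget-monotone T max _ _ same _ top' _ = top' _ same
  arcTarget-monotone T min _ _ same bot _ _ = bot _ (sym same)
  -- q' is a candidate for the least 'up' target of p
  arcTarget-monotone T up _ Tq'q same (_ , _ , least) (q'≢p' , p'≤q' , _) p≤p' =
    least _ (sym same) (distinct-below p≤p' p'≤q' q'≢p') Tq'q (≤-trans p≤p' p'≤q')
  -- q is a candidate for the greatest 'down' target of p'
  arcTarget-monotone T down Tqq' _ same (q≢p , q≤p , _) (_ , _ , greatest) p≤p' =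
    greatest _ same (distinct-above p≤p' q≤p q≢p) Tqq' (≤-trans q≤p p≤p')

  reach-refl : ∀ T m x → Reach 𝒫 T m x x
  reach-refl T zero    x = refl
  reach-refl T (suc m) x = inj₁ refl

  ⇔-sym : ∀ {A B : Set} → _⇔_ 𝒫 A B → _⇔_ 𝒫 B A
  ⇔-sym (to , from) = from , to

  iso-sym : ∀ T m {p p'} → (∀ {x y} → T x y → T y x) →
    Iso 𝒫 T m p p' → Iso 𝒫 T m p' p
  iso-sym T m {p} T-sym (f , g , f∈ , g∈ , gf , fg , fp , f-label , f-pres) =
    g , f , g∈ , f∈ , fg , gf , g-root , g-label , g-pres
    where
      g-root : g _ ≡ p
      g-root = trans (cong g (sym fp)) (gf p (reach-refl T m p))

      g-label : ∀ y → Reach 𝒫 T m _ y → T y (g y)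
      g-label y y∈ = T-sym (subst (T (g y)) (fg y y∈) (f-label (g y) (g∈ y y∈)))

      g-pres : ∀ y y' → Reach 𝒫 T m _ y → Reach 𝒫 T m _ y' →
        _⇔_ 𝒫 (y ≤P y') (g y ≤P g y') ×
        (∀ l → _⇔_ 𝒫 (Arc 𝒫 T l y y') (Arc 𝒫 T l (g y) (g y')))
      g-pres y y' y∈ y'∈ with f-pres (g y) (g y') (g∈ y y∈) (g∈ y' y'∈)
      ... | ≤-pres , arc-pres =
        ⇔-sym (subst₂ (λ a b → _⇔_ 𝒫 (g y ≤P g y') (a ≤P b)) (fg y y∈) (fg y' y'∈) ≤-pres) ,
        λ l → ⇔-sym (subst₂ (λ a b → _⇔_ 𝒫 (Arc 𝒫 T l (g y) (g y')) (Arc 𝒫 T l a b))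
                            (fg y y∈) (fg y' y'∈) (arc-pres l))

  -- τ_s-equality is symmetric; needed since 'up' arcs compare labels in the
  -- opposite direction to 'down' arcs.
  tauEq-sym : ∀ s {x y} → TauEq 𝒫 s x y → TauEq 𝒫 s y x
  tauEq-sym zero    (same-colour , same-chain) = sym same-colour , sym same-chain
  tauEq-sym (suc s) iso = iso-sym (TauEq 𝒫 s) (r s) (tauEq-sym s) iso

  -- τ_s determines the chain: τ_0 records it, and an isomorphism
  -- 𝒜_s(x) ≅ 𝒜_s(y) sends x to y preserving τ_s.
  tauEq-chain : ∀ s {x y} → TauEq 𝒫 s x y → chainOf x ≡ chainOf y
  tauEq-chain zero    (_ , same-chain) = same-chain
  tauEq-chain (suc s) {x} (f , _ , _ , _ , _ , _ , fx≡y , f-label , _) =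
    subst (λ z → chainOf x ≡ chainOf z) fx≡y
      (tauEq-chain s (f-label x (reach-refl _ (r s) x)))

lemma3p4 : (𝒫 : ColoredPoset) (s : ℕ) (p p' q q' : P 𝒫) (l : Label) →
    TauEq 𝒫 s p p' → TauEq 𝒫 s q q' →
    D 𝒫 s l p q → D 𝒫 s l p' q' →
    ColoredPoset._≤P_ 𝒫 p p' → ColoredPoset._≤P_ 𝒫 q q'
lemma3p4 𝒫 s p p' q q' l _ τq≡τq' =
  arcTarget-monotone 𝒫 (TauEq 𝒫 s) l
    τq≡τq' (tauEq-sym 𝒫 s τq≡τq') (tauEq-chain 𝒫 s τq≡τq')
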